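{- Fix any integer $\ell \ge 2$ and let $d = 2^{\ell-1} + 2^{\ell-2}$. For $n \ge 1$, let $S_{2^\ell}:\{0,1\}^n \to \{0,1\}$ be the elementary symmetric polynomial of degree $2^\ell$ over $\mathbb{F}_2$, i.e. $S_{2^\ell}(x) = \binom{|x|}{2^\ell} \bmod 2$. Then $$\gamma_{d,3}(S_{2^\ell}) \ge \frac{9}{16} - o(1),$$ where $o(1)$ denotes a quantity (depending on $\ell$ and $n$) that tends to $0$ as $n \to \infty$.
   Context: For $x\in\{0,1\}^n$, $|x|$ is its Hamming weight. For a Boolean function $F:\{0,1\}^n\to\{0,1\}$ and $k\ge 1$, the $k$-lift of $F$ is $F_k:\{0,1\}^n\to \mathbb{Z}/2^k\mathbb{Z}$ with $F_k(x)=0$ if $F(x)=0$ and $F_k(x)=2^{k-1}$ if $F(x)=1$. $\mathcal{P}_{d,k}$ denotes the set of multilinear polynomials in $x_1,\dots,x_n$ of degree at most $d$ with coefficients in $\mathbb{Z}/2^k\mathbb{Z}$, evaluated on $\{0,1\}^n$. For functions $F,G$ on a finite domain $D$, $\mathrm{agr}(F,G)=\Pr_{x\sim D}[F(x)=G(x)]$ with $x$ uniform. Finally $\gamma_{d,k}(F)=\max_{Q\in\mathcal{P}_{d,k}}\mathrm{agr}(F_k,Q)$. -}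

module Defs where

open import Data.Nat using (ℕ; zero; suc; _+_; _*_; _∸_; _^_; _<_; _%_)
open import Data.Nat.Combinatorics using (_C_)
open import Data.Bool using (Bool; true; false; if_then_else_)
open import Data.Fin using (Fin; toℕ)
open import Data.Vec using (Vec; []; _∷_)
open import Data.List using (List; [_]; map; _++_; filter; length)
open import Data.Nat.ListAction using (sum)
open import Data.Nat.Properties using (m^n≢0)
open import Relation.Binary.PropositionalEquality using (_≡_)
import Data.Nat as ℕ

Cube : ℕ → Set
Cube n = Vec Bool n

allCube : (n : ℕ) → List (Cube n)
allCube zero = [ [] ]
allCube (suc n) = map (false ∷_) (allCube n) ++ map (true ∷_) (allCube n)

weight : {n : ℕ} → Cube n → ℕ
weight [] = 0
weight (false ∷ x) = weight x
weight (true ∷ x) = suc (weight x)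

-- Multilinear monomial x^S = ∏_{i ∈ S} x_i (S given by its indicator vector)
monomial : {n : ℕ} → Cube n → Cube n → ℕ
monomial [] [] = 1
monomial (false ∷ S) (_ ∷ x) = monomial S x
monomial (true ∷ S) (b ∷ x) = (if b then 1 else 0) * monomial S x

-- Multilinear polynomials of degree ≤ d over ℤ/2^k ℤ:
-- one coefficient in Fin (2^k) ≅ ℤ/2^kℤ per monomial, zero on monomials of degree > d
record Poly (n d k : ℕ) : Set where
  field
    coef : Cube n → Fin (2 ^ k)
    degree-ok : ∀ S → d < weight S → toℕ (coef S) ≡ 0

eval : {n d k : ℕ} → Poly n d k → Cube n → ℕ
eval {n} {d} {k} Q x =
  sum (map (λ S → toℕ (Poly.coef Q S) * monomial S x) (allCube n)) % (2 ^ k)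
  where instance _ = m^n≢0 2 k

lift : {n : ℕ} → (k : ℕ) → (Cube n → Bool) → Cube n → ℕ
lift k F x = if F x then 2 ^ (k ∸ 1) else 0

-- Number of points of {0,1}^n where F_k and Q agree  (agr = this / 2^n)
agreeCount : {n d k : ℕ} → (Cube n → Bool) → Poly n d k → ℕ
agreeCount {n} {d} {k} F Q =
  length (filter (λ x → eval Q x ℕ.≟ lift k F x) (allCube n))

symElem : {n : ℕ} → ℕ → Cube n → Bool
symElem m x = (weight x C m) % 2 ℕ.≡ᵇ 1

degℓ : ℕ → ℕ
degℓ ℓ = 2 ^ (ℓ ∸ 1) + 2 ^ (ℓ ∸ 2)

-- Take Q = Σ_{|S| = d} x^S, so that Q(x) = C(|x|, 3D) mod 8 with D = 2^(ℓ-2), while the lift of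
-- S_{4D} is 4·(C(|x|, 4D) mod 2). Binary digits below D change these binomial coefficients only
-- by odd factors, so with q = ⌊|x|/D⌋ we get C(|x|, 3D) ≡ C(q, 3) (mod 8) whenever 4 ∣ C(q, 3), and
-- C(|x|, 4D) ≡ ⌊q/4⌋ (mod 2). Since C(q, 3) mod 8 has period 16 in q, Q agrees with the lift
-- whenever q mod 16 is even or 1: 9 of the 16 residues. Finally |x| equidistributes modulo
-- M = 16D: every further M - 1 coordinates shrink the deviation from the uniform count by the
-- factor (2^(M-1) - M) / 2^(M-1), so the proportion of good weights tends to 9/16.

module Submission where

open import Defs
open import Data.Bool using (Bool; true; false; T; if_then_else_; _∨_)
open import Data.Bool.Properties using (T?)
open import Data.Fin using (Fin; toℕ; fromℕ<; #_)
open import Data.Fin.Properties using (all?; toℕ-fromℕ<; toℕ<n)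
open import Data.Nat
open import Data.Nat.Combinatorics using (_C_; nCk+nC[k+1]≡[n+1]C[k+1]; k>n⇒nCk≡0; nC1≡n; nCk≡nC[n∸k])
open import Data.Nat.DivMod
open import Data.Nat.Divisibility using (divides)
open import Data.Nat.Properties
open import Data.Nat.Tactic.RingSolver using (solve-∀)
open import Algebra.Properties.CommutativeSemigroup *-commutativeSemigroup using (xy∙z≈xz∙y; xy∙z≈x∙zy; x∙yz≈y∙xz)
open import Data.Product using (∃-syntax; _,_)
open import Data.List using (map; _++_; filter; length)
import Data.List as List
open import Data.List.Properties using (map-++; map-cong; map-∘)
open import Data.Nat.ListAction using (sum)
open import Data.Nat.ListAction.Properties using (sum-++)
open import Data.Vec using ([]; _∷_)
open import Function using (_∘_; const)
open import Relation.Binary.PropositionalEquality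
open import Relation.Nullary.Decidable using (Dec; yes; no; toWitness; map′; _→-dec_; dec-false)
open import Relation.Nullary.Negation using (contradiction)

decide-below : ∀ {P : ℕ → Set} → (∀ x → Dec (P x)) → ∀ n → Dec (∀ x → x < n → P x)
decide-below {P} P? n = map′ (λ h x x<n → subst P (toℕ-fromℕ< x<n) (h (fromℕ< x<n)))
                             (λ h i → h (toℕ i) (toℕ<n i))
                             (all? (λ i → P? (toℕ i)))

-- Equality up to odd factors

Odd : ℕ → Set
Odd o = o % 2 ≡ 1

infix 4 _∼_

data _∼_ (X Y : ℕ) : Set where
  odd-factors : ∀ o o′ → Odd o → Odd o′ → X * o ≡ Y * o′ → X ∼ Y

odd-* : ∀ o o′ → Odd o → Odd o′ → Odd (o * o′)
odd-* o o′ odd-o odd-o′ = trans (%-distribˡ-* o o′ 2) (cong₂ (λ x y → (x * y) % 2) odd-o odd-o′)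

odd-1+2* : ∀ x → Odd (1 + 2 * x)
odd-1+2* x = trans (cong (λ y → (1 + y) % 2) (*-comm 2 x)) ([m+kn]%n≡m%n 1 x 2)

∼-reflexive : ∀ {X Y} → X ≡ Y → X ∼ Y
∼-reflexive refl = odd-factors 1 1 refl refl refl

∼-trans : ∀ {X Y Z} → X ∼ Y → Y ∼ Z → X ∼ Z
∼-trans {X} {Y} {Z} (odd-factors o₁ o₁′ p₁ p₁′ e₁) (odd-factors o₂ o₂′ p₂ p₂′ e₂) =
  odd-factors (o₁ * o₂) (o₁′ * o₂′) (odd-* o₁ o₂ p₁ p₂) (odd-* o₁′ o₂′ p₁′ p₂′) (begin
    X * (o₁ * o₂)    ≡⟨ *-assoc X o₁ o₂ ⟨
    X * o₁ * o₂      ≡⟨ cong (_* o₂) e₁ ⟩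
    Y * o₁′ * o₂     ≡⟨ xy∙z≈xz∙y Y o₁′ o₂ ⟩
    Y * o₂ * o₁′     ≡⟨ cong (_* o₁′) e₂ ⟩
    Z * o₂′ * o₁′    ≡⟨ xy∙z≈x∙zy Z o₂′ o₁′ ⟩
    Z * (o₁′ * o₂′)  ∎)
  where open ≡-Reasoning

∼-parity : ∀ {X Y} → X ∼ Y → X % 2 ≡ Y % 2
∼-parity {X} {Y} (odd-factors o o′ p p′ e) =
  trans (sym (*-odd-parity X p)) (trans (cong (_% 2) e) (*-odd-parity Y p′))
  where
    *-odd-parity : ∀ Z {o} → Odd o → (Z * o) % 2 ≡ Z % 2
    *-odd-parity Z {o} odd-o = begin
      (Z * o) % 2              ≡⟨ %-distribˡ-* Z o 2 ⟩
      (Z % 2 * (o % 2)) % 2    ≡⟨ cong (λ y → (Z % 2 * y) % 2) odd-o ⟩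
      (Z % 2 * 1) % 2          ≡⟨ cong (_% 2) (*-identityʳ (Z % 2)) ⟩
      Z % 2 % 2                ≡⟨ m%n%n≡m%n Z 2 ⟩
      Z % 2                    ∎
      where open ≡-Reasoning

odd-scaling-mod8 : ∀ x → x < 8 → ∀ p → p < 8 → Odd p → (x * p) % 4 ≡ 0 → (x * p) % 8 ≡ x
odd-scaling-mod8 = toWitness {a? = decide-below (λ x → decide-below (λ p →
  p % 2 ≟ 1 →-dec (x * p) % 4 ≟ 0 →-dec (x * p) % 8 ≟ x) 8) 8} _

*-odd-mod8 : ∀ Z {o} → Odd o → (Z * o) % 4 ≡ 0 → (Z * o) % 8 ≡ Z % 8
*-odd-mod8 Z {o} odd-o 4∣Zo = trans (%-distribˡ-* Z o 8)
  (odd-scaling-mod8 (Z % 8) (m%n<n Z 8) (o % 8) (m%n<n o 8) odd-o%8 4∣Zo%8)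
  where
    odd-o%8 : Odd (o % 8)
    odd-o%8 = trans (m∣n⇒o%n%m≡o%m 2 8 o (divides 4 refl)) odd-o
    4∣Zo%8 : (Z % 8 * (o % 8)) % 4 ≡ 0
    4∣Zo%8 = begin
      (Z % 8 * (o % 8)) % 4      ≡⟨ m∣n⇒o%n%m≡o%m 4 8 (Z % 8 * (o % 8)) (divides 2 refl) ⟨
      (Z % 8 * (o % 8)) % 8 % 4  ≡⟨ cong (_% 4) (%-distribˡ-* Z o 8) ⟨
      (Z * o) % 8 % 4            ≡⟨ m∣n⇒o%n%m≡o%m 4 8 (Z * o) (divides 2 refl) ⟩
      (Z * o) % 4                ≡⟨ 4∣Zo ⟩
      0                          ∎
      where open ≡-Reasoning

∼-mod8 : ∀ {X Y} → X ∼ Y → Y % 4 ≡ 0 → X % 8 ≡ Y % 8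
∼-mod8 {X} {Y} (odd-factors o o′ p p′ e) 4∣Y = begin
    X % 8         ≡⟨ *-odd-mod8 X p (trans (cong (_% 4) e) 4∣Yo′) ⟨
    (X * o) % 8   ≡⟨ cong (_% 8) e ⟩
    (Y * o′) % 8  ≡⟨ *-odd-mod8 Y p′ 4∣Yo′ ⟩
    Y % 8         ∎
  where
    open ≡-Reasoning
    4∣Yo′ : (Y * o′) % 4 ≡ 0
    4∣Yo′ = trans (%-distribˡ-* Y o′ 4) (cong (λ y → (y * (o′ % 4)) % 4) 4∣Y)

∼-ratio : ∀ {X Y U V} c d → X * suc c ≡ Y * d → U * suc c ≡ V * d → Y ∼ V → X ∼ U
∼-ratio {X} {Y} {U} {V} c d X∶Y U∶V (odd-factors o o′ p p′ e) = odd-factors o o′ p p′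
  (*-cancelʳ-≡ (X * o) (U * o′) (suc c) (begin
    X * o * suc c   ≡⟨ xy∙z≈xz∙y X o (suc c) ⟩
    X * suc c * o   ≡⟨ cong (_* o) X∶Y ⟩
    Y * d * o       ≡⟨ xy∙z≈xz∙y Y d o ⟩
    Y * o * d       ≡⟨ cong (_* d) e ⟩
    V * o′ * d      ≡⟨ xy∙z≈xz∙y V o′ d ⟩
    V * d * o′      ≡⟨ cong (_* o′) U∶V ⟨
    U * suc c * o′  ≡⟨ xy∙z≈xz∙y U (suc c) o′ ⟩
    U * o′ * suc c  ∎))
  where open ≡-Reasoning

-- Binomial coefficients modulo 8

C-suc-suc : ∀ n k → suc n C suc k ≡ n C k + n C suc k
C-suc-suc n k = sym (nCk+nC[k+1]≡[n+1]C[k+1] n k)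

C-absorb : ∀ n k → (suc n C suc k) * suc k ≡ (n C k) * suc n
C-absorb zero zero = refl
C-absorb zero (suc k) = cong (_* suc (suc k)) (k>n⇒nCk≡0 {1} {suc (suc k)} (s≤s (s≤s z≤n)))
C-absorb (suc n) zero = begin
    (suc (suc n) C 1) * 1  ≡⟨ *-identityʳ (suc (suc n) C 1) ⟩
    suc (suc n) C 1        ≡⟨ nC1≡n (suc (suc n)) ⟩
    suc (suc n)            ≡⟨ *-identityˡ (suc (suc n)) ⟨
    1 * suc (suc n)        ∎
  where open ≡-Reasoning
C-absorb (suc n) (suc k) = begin
    (suc (suc n) C suc (suc k)) * suc (suc k)
  ≡⟨ cong (_* suc (suc k)) (C-suc-suc (suc n) (suc k)) ⟩
    (a + b) * suc (suc k)
  ≡⟨ regroup a b k ⟩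
    a * suc k + b * suc (suc k) + a
  ≡⟨ cong₂ (λ x y → x + y + a) (C-absorb n k) (C-absorb n (suc k)) ⟩
    (n C k) * suc n + (n C suc k) * suc n + a
  ≡⟨ cong (_+ a) (*-distribʳ-+ (suc n) (n C k) (n C suc k)) ⟨
    (n C k + n C suc k) * suc n + a
  ≡⟨ cong (λ x → x * suc n + a) (C-suc-suc n k) ⟨
    a * suc n + a
  ≡⟨ trans (*-suc a (suc n)) (+-comm a (a * suc n)) ⟨
    a * suc (suc n)
  ∎
  where
    open ≡-Reasoning
    a = suc n C suc k
    b = suc n C suc (suc k)
    regroup : ∀ a b k → (a + b) * suc (suc k) ≡ a * suc k + b * suc (suc k) + a
    regroup = solve-∀

C-sym-+ : ∀ k m → (k + m) C k ≡ (m + k) C m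
C-sym-+ k m = trans (nCk≡nC[n∸k] (m≤m+n k m)) (cong₂ _C_ (+-comm k m) (m+n∸m≡n k m))

C-absorb-complement : ∀ k m → (suc (k + m) C k) * suc m ≡ ((k + m) C k) * suc (k + m)
C-absorb-complement k m = begin
    (suc (k + m) C k) * suc m      ≡⟨ cong (λ n → (n C k) * suc m) (+-suc k m) ⟨
    ((k + suc m) C k) * suc m      ≡⟨ cong (_* suc m) (C-sym-+ k (suc m)) ⟩
    (suc (m + k) C suc m) * suc m  ≡⟨ C-absorb (m + k) m ⟩
    ((m + k) C m) * suc (m + k)    ≡⟨ cong₂ (λ x y → x * suc y) (C-sym-+ k m) (+-comm k m) ⟨
    ((k + m) C k) * suc (k + m)    ∎
  where open ≡-Reasoning

odd-1+2[+] : ∀ k m → Odd (1 + (2 * k + 2 * m))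
odd-1+2[+] k m = subst (λ z → Odd (1 + z)) (*-distribˡ-+ 2 k m) (odd-1+2* (k + m))

two-suc : ∀ k → 2 * suc k ≡ suc (suc (2 * k))
two-suc = solve-∀

C-double-diag : ∀ k m → (2 * k + 2 * m) C (2 * k) ∼ (k + m) C k
C-double-diag zero m = ∼-reflexive refl
C-double-diag (suc k) m =
  subst₂ (λ a b → a C b ∼ (suc k + m) C suc k) (sym (two-suc+ k m)) (sym (two-suc k))
    (∼-ratio {Y = Y} k (suc (k + m)) X∶Y (C-absorb (k + m) k)
      (∼-trans (odd-factors (suc (2 * k)) (suc n) (odd-1+2* k) (odd-1+2[+] k m) (C-absorb n (2 * k)))
               (C-double-diag k m)))
  where
    n = 2 * k + 2 * m
    X = suc (suc n) C suc (suc (2 * k))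
    Y = suc n C suc (2 * k)
    double : ∀ x k → x * suc (suc (2 * k)) ≡ 2 * (x * suc k)
    double = solve-∀
    double+ : ∀ y k m → y * suc (suc (2 * k + 2 * m)) ≡ 2 * (y * suc (k + m))
    double+ = solve-∀
    two-suc+ : ∀ k m → 2 * suc k + 2 * m ≡ suc (suc (2 * k + 2 * m))
    two-suc+ = solve-∀
    X∶Y : X * suc k ≡ Y * suc (k + m)
    X∶Y = *-cancelˡ-≡ _ _ 2 (trans (sym (double X k)) (trans (C-absorb (suc n) (suc (2 * k))) (double+ Y k m)))

C-double : ∀ A B → (2 * A) C (2 * B) ∼ A C B
C-double A B with B ≤? A
... | yes B≤A = subst (λ a → (2 * a) C (2 * B) ∼ a C B) (m+[n∸m]≡n B≤A)
                  (subst (λ n → n C (2 * B) ∼ (B + m) C B) (sym (*-distribˡ-+ 2 B m)) (C-double-diag B m))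
  where m = A ∸ B
... | no B≰A = ∼-reflexive (trans (k>n⇒nCk≡0 (*-monoʳ-< 2 A<B)) (sym (k>n⇒nCk≡0 A<B)))
  where A<B = ≰⇒> B≰A

C-double-suc : ∀ A B → (1 + 2 * A) C (2 * B) ∼ (2 * A) C (2 * B)
C-double-suc A B with B ≤? A
... | yes B≤A = subst (λ a → (1 + 2 * a) C (2 * B) ∼ (2 * a) C (2 * B)) (m+[n∸m]≡n B≤A)
                  (subst (λ n → (1 + n) C (2 * B) ∼ n C (2 * B)) (sym (*-distribˡ-+ 2 B m))
                    (odd-factors (suc (2 * m)) (suc (2 * B + 2 * m)) (odd-1+2* m) (odd-1+2[+] B m)
                      (C-absorb-complement (2 * B) (2 * m))))
  where m = A ∸ B
... | no B≰A = ∼-reflexive (trans (k>n⇒nCk≡0 1+2A<2B) (sym (k>n⇒nCk≡0 (*-monoʳ-< 2 (≰⇒> B≰A)))))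
  where
    1+2A<2B : 1 + 2 * A < 2 * B
    1+2A<2B = subst (_≤ 2 * B) (two-suc A) (*-monoʳ-≤ 2 (≰⇒> B≰A))

C-halve : ∀ e A B → e < 2 → (e + 2 * A) C (2 * B) ∼ A C B
C-halve 0 A B _ = C-double A B
C-halve 1 A B _ = ∼-trans (C-double-suc A B) (C-double A B)
C-halve (suc (suc _)) A B (s≤s (s≤s ()))

C-digits : ∀ s q r j → r < 2 ^ s → (q * 2 ^ s + r) C (j * 2 ^ s) ∼ q C j
C-digits zero q zero j _ = ∼-reflexive (cong₂ _C_ (trans (+-identityʳ _) (*-identityʳ q)) (*-identityʳ j))
C-digits zero q (suc r) j (s≤s ())
C-digits (suc s) q r j r<2^1+s =
  ∼-trans (subst₂ (λ a b → a C b ∼ A C B) top bottom (C-halve (r % 2) A B (m%n<n r 2)))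
          (C-digits s q (r / 2) j (m<n*o⇒m/o<n (subst (r <_) (*-comm 2 (2 ^ s)) r<2^1+s)))
  where
    A = q * 2 ^ s + r / 2
    B = j * 2 ^ s
    regroup : ∀ a b q p → a + 2 * (q * p + b) ≡ q * (2 * p) + (a + b * 2)
    regroup = solve-∀
    top : r % 2 + 2 * A ≡ q * 2 ^ suc s + r
    top = trans (regroup (r % 2) (r / 2) q (2 ^ s)) (cong (q * 2 ^ suc s +_) (sym (m≡m%n+[m/n]*n r 2)))
    bottom : 2 * B ≡ j * 2 ^ suc s
    bottom = x∙yz≈y∙xz 2 j (2 ^ s)

C-quotient : ∀ s w j → w C (j * 2 ^ s) ∼ ((w / 2 ^ s) {{m^n≢0 2 s}}) C j
C-quotient s w j = subst (λ a → a C (j * D) ∼ q C j) (trans (+-comm (q * D) r) (sym (m≡m%n+[m/n]*n w D)))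
                         (C-digits s q r j (m%n<n w D))
  where
    instance _ = m^n≢0 2 s
    D = 2 ^ s
    q = w / D
    r = w % D

C-shift16-2 : ∀ u → (u + 16) C 2 ≡ u C 2 + 16 * u + 120
C-shift16-2 zero = refl
C-shift16-2 (suc u) = begin
    suc (u + 16) C 2                       ≡⟨ C-suc-suc (u + 16) 1 ⟩
    (u + 16) C 1 + (u + 16) C 2            ≡⟨ cong₂ _+_ (nC1≡n (u + 16)) (C-shift16-2 u) ⟩
    u + 16 + (u C 2 + 16 * u + 120)        ≡⟨ regroup u (u C 2) ⟩
    u + u C 2 + 16 * suc u + 120           ≡⟨ cong (λ x → x + u C 2 + 16 * suc u + 120) (nC1≡n u) ⟨
    u C 1 + u C 2 + 16 * suc u + 120       ≡⟨ cong (λ x → x + 16 * suc u + 120) (C-suc-suc u 1) ⟨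
    suc u C 2 + 16 * suc u + 120           ∎
  where
    open ≡-Reasoning
    regroup : ∀ u c → u + 16 + (c + 16 * u + 120) ≡ u + c + 16 * suc u + 120
    regroup = solve-∀

C-shift16-3 : ∀ u → (u + 16) C 3 ≡ u C 3 + 16 * (u C 2) + 120 * u + 560
C-shift16-3 zero = refl
C-shift16-3 (suc u) = begin
    suc (u + 16) C 3
  ≡⟨ C-suc-suc (u + 16) 2 ⟩
    (u + 16) C 2 + (u + 16) C 3
  ≡⟨ cong₂ _+_ (C-shift16-2 u) (C-shift16-3 u) ⟩
    u C 2 + 16 * u + 120 + (u C 3 + 16 * (u C 2) + 120 * u + 560)
  ≡⟨ regroup u (u C 2) (u C 3) ⟩
    u C 2 + u C 3 + 16 * (u + u C 2) + 120 * suc u + 560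
  ≡⟨ cong (λ x → u C 2 + u C 3 + 16 * (x + u C 2) + 120 * suc u + 560) (nC1≡n u) ⟨
    u C 2 + u C 3 + 16 * (u C 1 + u C 2) + 120 * suc u + 560
  ≡⟨ cong₂ (λ x y → x + 16 * y + 120 * suc u + 560) (C-suc-suc u 2) (C-suc-suc u 1) ⟨
    suc u C 3 + 16 * (suc u C 2) + 120 * suc u + 560
  ∎
  where
    open ≡-Reasoning
    regroup : ∀ u b c → b + 16 * u + 120 + (c + 16 * b + 120 * u + 560) ≡ b + c + 16 * (u + b) + 120 * suc u + 560
    regroup = solve-∀

C3-mod8-periodic : ∀ t u → ((u + t * 16) C 3) % 8 ≡ (u C 3) % 8
C3-mod8-periodic zero u = cong (λ n → (n C 3) % 8) (+-identityʳ u)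
C3-mod8-periodic (suc t) u = begin
    ((u + suc t * 16) C 3) % 8                     ≡⟨ cong (λ n → (n C 3) % 8) (regroup u t) ⟩
    ((v + 16) C 3) % 8                             ≡⟨ cong (_% 8) (trans (C-shift16-3 v) (multiple-of-8 (v C 3) (v C 2) v)) ⟩
    (v C 3 + (2 * (v C 2) + 15 * v + 70) * 8) % 8  ≡⟨ [m+kn]%n≡m%n (v C 3) (2 * (v C 2) + 15 * v + 70) 8 ⟩
    (v C 3) % 8                                    ≡⟨ C3-mod8-periodic t u ⟩
    (u C 3) % 8                                    ∎
  where
    open ≡-Reasoning
    v = u + t * 16
    regroup : ∀ u t → u + suc t * 16 ≡ u + t * 16 + 16
    regroup = solve-∀
    multiple-of-8 : ∀ c b v → c + 16 * b + 120 * v + 560 ≡ c + (2 * b + 15 * v + 70) * 8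
    multiple-of-8 = solve-∀

goodResidue : ℕ → Bool
goodResidue u = (u % 2 ≡ᵇ 0) ∨ (u ≡ᵇ 1)

C3-mod8-goodResidue : ∀ u → u < 16 → T (goodResidue u) → (u C 3) % 8 ≡ 4 * (u / 4 % 2)
C3-mod8-goodResidue = toWitness {a? = decide-below (λ u →
  T? (goodResidue u) →-dec (u C 3) % 8 ≟ 4 * (u / 4 % 2)) 16} _

n/4%2≡n%16/4%2 : ∀ n → n / 4 % 2 ≡ n % 16 / 4 % 2
n/4%2≡n%16/4%2 n = begin
    n / 4 % 2                                   ≡⟨ cong (λ a → a / 4 % 2) (m≡m%n+[m/n]*n n 16) ⟩
    (n % 16 + t * 16) / 4 % 2                   ≡⟨ cong (_% 2) (+-distrib-/-∣ʳ (n % 16) (divides (t * 4) (sixteen t))) ⟩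
    (n % 16 / 4 + t * 16 / 4) % 2               ≡⟨ cong (λ a → (n % 16 / 4 + a) % 2) (trans (/-congˡ (sixteen t)) (m*n/n≡m (t * 4) 4)) ⟩
    (n % 16 / 4 + t * 4) % 2                    ≡⟨ cong (λ a → (n % 16 / 4 + a) % 2) (four t) ⟩
    (n % 16 / 4 + t * 2 * 2) % 2                ≡⟨ [m+kn]%n≡m%n (n % 16 / 4) (t * 2) 2 ⟩
    n % 16 / 4 % 2                              ∎
  where
    open ≡-Reasoning
    t = n / 16
    sixteen : ∀ t → t * 16 ≡ t * 4 * 4
    sixteen = solve-∀
    four : ∀ t → t * 4 ≡ t * 2 * 2
    four = solve-∀

-- Sums over the cube

-- weightSum n F = Σᵢ C(n, i) F i, the sum of F |x| over x ∈ {0,1}ⁿ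
weightSum : ℕ → (ℕ → ℕ) → ℕ
weightSum zero F = F 0
weightSum (suc n) F = weightSum n F + weightSum n (F ∘ suc)

weightSum-cong : ∀ n {F G} → (∀ i → F i ≡ G i) → weightSum n F ≡ weightSum n G
weightSum-cong zero F≗G = F≗G 0
weightSum-cong (suc n) F≗G = cong₂ _+_ (weightSum-cong n F≗G) (weightSum-cong n (F≗G ∘ suc))

weightSum-+ : ∀ n F G → weightSum n (λ i → F i + G i) ≡ weightSum n F + weightSum n G
weightSum-+ zero F G = refl
weightSum-+ (suc n) F G = trans (cong₂ _+_ (weightSum-+ n F G) (weightSum-+ n (F ∘ suc) (G ∘ suc)))
                                (+-comm-middle (weightSum n F) (weightSum n G) _ _)
  where
    +-comm-middle : ∀ a b c d → a + b + (c + d) ≡ a + c + (b + d)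
    +-comm-middle = solve-∀

weightSum-const : ∀ n c → weightSum n (λ _ → c) ≡ c * 2 ^ n
weightSum-const zero c = sym (*-identityʳ c)
weightSum-const (suc n) c = trans (cong₂ _+_ (weightSum-const n c) (weightSum-const n c)) (double c (2 ^ n))
  where
    double : ∀ c p → c * p + c * p ≡ c * (2 * p)
    double = solve-∀

weightSum-+-length : ∀ s n F → weightSum (s + n) F ≡ weightSum s (λ i → weightSum n (λ j → F (i + j)))
weightSum-+-length zero n F = refl
weightSum-+-length (suc s) n F = cong₂ _+_ (weightSum-+-length s n F) (weightSum-+-length s n (F ∘ suc))

sumBelow : ℕ → (ℕ → ℕ) → ℕ
sumBelow zero F = 0
sumBelow (suc n) F = F 0 + sumBelow n (F ∘ suc)

sumBelow-cong< : ∀ n {F G} → (∀ i → i < n → F i ≡ G i) → sumBelow n F ≡ sumBelow n G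
sumBelow-cong< zero F≗G = refl
sumBelow-cong< (suc n) F≗G = cong₂ _+_ (F≗G 0 z<s) (sumBelow-cong< n (λ i i<n → F≗G (suc i) (s<s i<n)))

sumBelow-cong : ∀ n {F G} → (∀ i → F i ≡ G i) → sumBelow n F ≡ sumBelow n G
sumBelow-cong n F≗G = sumBelow-cong< n (λ i _ → F≗G i)

sumBelow-const : ∀ n c → sumBelow n (λ _ → c) ≡ n * c
sumBelow-const zero c = refl
sumBelow-const (suc n) c = cong (c +_) (sumBelow-const n c)

sumBelow-*ˡ : ∀ n c F → sumBelow n (λ i → c * F i) ≡ c * sumBelow n F
sumBelow-*ˡ zero c F = sym (*-zeroʳ c)
sumBelow-*ˡ (suc n) c F = trans (cong (c * F 0 +_) (sumBelow-*ˡ n c (F ∘ suc))) (sym (*-distribˡ-+ c (F 0) _))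

sumBelow-+-length : ∀ a b F → sumBelow (a + b) F ≡ sumBelow a F + sumBelow b (λ j → F (a + j))
sumBelow-+-length zero b F = refl
sumBelow-+-length (suc a) b F = trans (cong (F 0 +_) (sumBelow-+-length a b (F ∘ suc))) (sym (+-assoc (F 0) _ _))

sumBelow-suc : ∀ n F → sumBelow (suc n) F ≡ sumBelow n F + F n
sumBelow-suc zero F = +-identityʳ (F 0)
sumBelow-suc (suc n) F = trans (cong (F 0 +_) (sumBelow-suc n (F ∘ suc))) (sym (+-assoc (F 0) _ _))

sumBelow-weightSum : ∀ m n (H : ℕ → ℕ → ℕ) → sumBelow m (λ j → weightSum n (H j)) ≡ weightSum n (λ i → sumBelow m (λ j → H j i))
sumBelow-weightSum zero n H = sym (weightSum-const n 0)
sumBelow-weightSum (suc m) n H =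
  trans (cong (weightSum n (H 0) +_) (sumBelow-weightSum m n (λ j → H (suc j))))
        (sym (weightSum-+ n (H 0) (λ i → sumBelow m (λ j → H (suc j) i))))

sumBelow-blocks : ∀ k D F → sumBelow (k * D) F ≡ sumBelow k (λ u → sumBelow D (λ r → F (u * D + r)))
sumBelow-blocks zero D F = refl
sumBelow-blocks (suc k) D F = trans (sumBelow-+-length D (k * D) F)
  (cong (sumBelow D F +_) (trans (sumBelow-blocks k D (λ j → F (D + j)))
    (sumBelow-cong k (λ u → sumBelow-cong D (λ r → cong F (sym (+-assoc D (u * D) r)))))))

sumBelow-periodic : ∀ M (f : ℕ → ℕ) → (∀ c → f (c + M) ≡ f c) → ∀ c → sumBelow M (λ j → f (c + j)) ≡ sumBelow M f
sumBelow-periodic M f periodic zero = refl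
sumBelow-periodic M f periodic (suc c) = trans shift (sumBelow-periodic M f periodic c)
  where
    g : ℕ → ℕ
    g j = f (c + j)
    rotate : g 0 + sumBelow M (g ∘ suc) ≡ sumBelow M g + g 0
    rotate = trans (sumBelow-suc M g) (cong (sumBelow M g +_) (trans (periodic c) (cong f (sym (+-identityʳ c)))))
    shift : sumBelow M (λ j → f (suc c + j)) ≡ sumBelow M g
    shift = trans (sumBelow-cong M (λ j → cong f (sym (+-suc c j))))
                  (+-cancelˡ-≡ (g 0) _ _ (trans rotate (+-comm (sumBelow M g) (g 0))))

indicator : Bool → ℕ
indicator b = if b then 1 else 0

cubeSum : ∀ n → (Cube n → ℕ) → ℕ
cubeSum n f = sum (map f (allCube n))

cubeSum-cong : ∀ n {f g : Cube n → ℕ} → (∀ x → f x ≡ g x) → cubeSum n f ≡ cubeSum n g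
cubeSum-cong n f≗g = cong sum (map-cong f≗g (allCube n))

cubeSum-suc : ∀ n f → cubeSum (suc n) f ≡ cubeSum n (f ∘ (false ∷_)) + cubeSum n (f ∘ (true ∷_))
cubeSum-suc n f = begin
    sum (map f (map (false ∷_) xs ++ map (true ∷_) xs))                ≡⟨ cong sum (map-++ f (map (false ∷_) xs) _) ⟩
    sum (map f (map (false ∷_) xs) ++ map f (map (true ∷_) xs))        ≡⟨ sum-++ (map f (map (false ∷_) xs)) _ ⟩
    sum (map f (map (false ∷_) xs)) + sum (map f (map (true ∷_) xs))   ≡⟨ cong₂ (λ a b → sum a + sum b) (map-∘ xs) (map-∘ xs) ⟨
    cubeSum n (f ∘ (false ∷_)) + cubeSum n (f ∘ (true ∷_))             ∎
  where
    open ≡-Reasoning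
    xs = allCube n

cubeSum-weight : ∀ n F → cubeSum n (F ∘ weight) ≡ weightSum n F
cubeSum-weight zero F = +-identityʳ (F 0)
cubeSum-weight (suc n) F = trans (cubeSum-suc n (F ∘ weight)) (cong₂ _+_ (cubeSum-weight n F) (cubeSum-weight n (F ∘ suc)))

cubeSum-zero : ∀ n → cubeSum n (λ _ → 0) ≡ 0
cubeSum-zero n = trans (cubeSum-weight n (λ _ → 0)) (weightSum-const n 0)

cubeSum-monomials : ∀ n (x : Cube n) d → cubeSum n (λ S → indicator (weight S ≡ᵇ d) * monomial S x) ≡ weight x C d
cubeSum-monomials zero [] zero = refl
cubeSum-monomials zero [] (suc d) = refl
cubeSum-monomials (suc n) (false ∷ x) d =
  trans (cubeSum-suc n _)
        (trans (cong₂ _+_ (cubeSum-monomials n x d) (trans (cubeSum-cong n (λ S → *-zeroʳ (indicator (suc (weight S) ≡ᵇ d)))) (cubeSum-zero n)))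
               (+-identityʳ (weight x C d)))
cubeSum-monomials (suc n) (true ∷ x) zero =
  trans (cubeSum-suc n _) (cong₂ _+_ (cubeSum-monomials n x zero) (cubeSum-zero n))
cubeSum-monomials (suc n) (true ∷ x) (suc d) =
  trans (cubeSum-suc n _)
        (trans (cong₂ _+_ (cubeSum-monomials n x (suc d)) (trans unit-monomials (cubeSum-monomials n x d)))
               (trans (+-comm (weight x C suc d) (weight x C d)) (nCk+nC[k+1]≡[n+1]C[k+1] (weight x) d)))
  where
    unit-monomials : cubeSum n (λ S → indicator (weight S ≡ᵇ d) * (1 * monomial S x))
                   ≡ cubeSum n (λ S → indicator (weight S ≡ᵇ d) * monomial S x)
    unit-monomials = cubeSum-cong n (λ S → cong (indicator (weight S ≡ᵇ d) *_) (*-identityˡ (monomial S x)))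

bit : Bool → Fin 8
bit b = if b then # 1 else # 0

toℕ-bit : ∀ b → toℕ (bit b) ≡ indicator b
toℕ-bit true = refl
toℕ-bit false = refl

homogeneousSymmetric : ∀ n d → Poly n d 3
homogeneousSymmetric n d = record
  { coef = λ S → bit (weight S ≡ᵇ d)
  ; degree-ok = λ S d<|S| → trans (toℕ-bit (weight S ≡ᵇ d)) (cong indicator (dec-false (weight S ≟ d) (>⇒≢ d<|S|)))
  }

eval-homogeneousSymmetric : ∀ n d (x : Cube n) → eval (homogeneousSymmetric n d) x ≡ (weight x C d) % 8
eval-homogeneousSymmetric n d x = cong (_% 8)
  (trans (cubeSum-cong n (λ S → cong (_* monomial S x) (toℕ-bit (weight S ≡ᵇ d)))) (cubeSum-monomials n x d))

lift3-symElem : ∀ m {n} (x : Cube n) → lift 3 (symElem m) x ≡ 4 * ((weight x C m) % 2)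
lift3-symElem m x with (weight x C m) % 2 | m%n<n (weight x C m) 2
... | 0 | _ = refl
... | 1 | _ = refl
... | suc (suc _) | s≤s (s≤s ())

count≤length-filter : ∀ {A : Set} {P : A → Set} (P? : ∀ x → Dec (P x)) (q : A → Bool) →
                      (∀ x → T (q x) → P x) → ∀ xs → sum (map (indicator ∘ q) xs) ≤ length (filter P? xs)
count≤length-filter P? q q⇒P List.[] = z≤n
count≤length-filter P? q q⇒P (x List.∷ xs) with P? x | q x | q⇒P x
... | yes _ | true  | _ = s≤s (count≤length-filter P? q q⇒P xs)
... | yes _ | false | _ = m≤n⇒m≤1+n (count≤length-filter P? q q⇒P xs)
... | no ¬p | true  | p = contradiction (p _) ¬p
... | no _  | false | _ = count≤length-filter P? q q⇒P xs

-- Equidistribution of the weight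

-- mersenne m = 2^m ∸ 1 and excess m = 2^m ∸ suc m = Σᵢ (C(m, i) ∸ 1), by recursion to avoid truncated subtraction
mersenne : ℕ → ℕ
mersenne zero = 0
mersenne (suc m) = mersenne m + 2 ^ m

excess : ℕ → ℕ
excess zero = 0
excess (suc m) = mersenne m + excess m

suc-mersenne : ∀ m → suc (mersenne m) ≡ 2 ^ m
suc-mersenne zero = refl
suc-mersenne (suc m) = begin
    suc (mersenne m + 2 ^ m)  ≡⟨ cong (_+ 2 ^ m) (suc-mersenne m) ⟩
    2 ^ m + 2 ^ m             ≡⟨ cong (2 ^ m +_) (+-identityʳ (2 ^ m)) ⟨
    2 * 2 ^ m                 ∎
  where open ≡-Reasoning

excess+suc : ∀ m → excess m + suc m ≡ 2 ^ m
excess+suc zero = refl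
excess+suc (suc m) = begin
    mersenne m + excess m + suc (suc m)    ≡⟨ regroup (mersenne m) (excess m) m ⟩
    suc (mersenne m) + (excess m + suc m)  ≡⟨ cong₂ _+_ (suc-mersenne m) (excess+suc m) ⟩
    2 ^ m + 2 ^ m                          ≡⟨ cong (2 ^ m +_) (+-identityʳ (2 ^ m)) ⟨
    2 * 2 ^ m                              ∎
  where
    open ≡-Reasoning
    regroup : ∀ f e m → f + e + suc (suc m) ≡ suc f + (e + suc m)
    regroup = solve-∀

module _ (M X Y : ℕ) where

  LowerBound : (ℕ → ℕ) → Set
  LowerBound F = ∀ i → Y ≤ M * F i + X

  weightSum-lower : ∀ m F → LowerBound F → 2 ^ m * Y ≤ M * weightSum m F + 2 ^ m * X
  weightSum-lower zero F lower = subst₂ _≤_ (sym (*-identityˡ Y)) (cong (M * F 0 +_) (sym (*-identityˡ X))) (lower 0)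
  weightSum-lower (suc m) F lower = begin
      2 ^ suc m * Y
    ≡⟨ double (2 ^ m) Y ⟩
      2 ^ m * Y + 2 ^ m * Y
    ≤⟨ +-mono-≤ (weightSum-lower m F lower) (weightSum-lower m (F ∘ suc) (lower ∘ suc)) ⟩
      M * weightSum m F + 2 ^ m * X + (M * weightSum m (F ∘ suc) + 2 ^ m * X)
    ≡⟨ regroup M (weightSum m F) (weightSum m (F ∘ suc)) (2 ^ m) X ⟩
      M * weightSum (suc m) F + 2 ^ suc m * X
    ∎
    where
      open ≤-Reasoning
      double : ∀ p Y → 2 * p * Y ≡ p * Y + p * Y
      double = solve-∀
      regroup : ∀ M a b p X → M * a + p * X + (M * b + p * X) ≡ M * (a + b) + 2 * p * X
      regroup = solve-∀

  weightSum-lower-head : ∀ m F → LowerBound F → M * F 0 + mersenne m * Y ≤ M * weightSum m F + mersenne m * X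
  weightSum-lower-head zero F lower = ≤-refl
  weightSum-lower-head (suc m) F lower = begin
      M * F 0 + (mersenne m + 2 ^ m) * Y
    ≡⟨ regroup M (F 0) (mersenne m) (2 ^ m) Y ⟩
      M * F 0 + mersenne m * Y + 2 ^ m * Y
    ≤⟨ +-mono-≤ (weightSum-lower-head m F lower) (weightSum-lower m (F ∘ suc) (lower ∘ suc)) ⟩
      M * weightSum m F + mersenne m * X + (M * weightSum m (F ∘ suc) + 2 ^ m * X)
    ≡⟨ regroup′ M (weightSum m F) (weightSum m (F ∘ suc)) (mersenne m) (2 ^ m) X ⟩
      M * weightSum (suc m) F + (mersenne m + 2 ^ m) * X
    ∎
    where
      open ≤-Reasoning
      regroup : ∀ M a f p Y → M * a + (f + p) * Y ≡ M * a + f * Y + p * Y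
      regroup = solve-∀
      regroup′ : ∀ M a b f p X → M * a + f * X + (M * b + p * X) ≡ M * (a + b) + (f + p) * X
      regroup′ = solve-∀

  -- Each F i with i ≤ m occurs C(m, i) ≥ 1 times in weightSum m F; the excess m surplus copies are bounded below by the hypothesis.
  weightSum-lower-window : ∀ m F → LowerBound F → M * sumBelow (suc m) F + excess m * Y ≤ M * weightSum m F + excess m * X
  weightSum-lower-window zero F lower = ≤-reflexive (cong (λ a → M * a + 0) (+-identityʳ (F 0)))
  weightSum-lower-window (suc m) F lower = begin
      M * (F 0 + sumBelow (suc m) (F ∘ suc)) + (mersenne m + excess m) * Y
    ≡⟨ regroup M (F 0) (sumBelow (suc m) (F ∘ suc)) (mersenne m) (excess m) Y ⟩
      M * F 0 + mersenne m * Y + (M * sumBelow (suc m) (F ∘ suc) + excess m * Y)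
    ≤⟨ +-mono-≤ (weightSum-lower-head m F lower) (weightSum-lower-window m (F ∘ suc) (lower ∘ suc)) ⟩
      M * weightSum m F + mersenne m * X + (M * weightSum m (F ∘ suc) + excess m * X)
    ≡⟨ regroup M (weightSum m F) (weightSum m (F ∘ suc)) (mersenne m) (excess m) X ⟨
      M * weightSum (suc m) F + (mersenne m + excess m) * X
    ∎
    where
      open ≤-Reasoning
      regroup : ∀ M a b f e Y → M * (a + b) + (f + e) * Y ≡ M * a + f * Y + (M * b + e * Y)
      regroup = solve-∀

2^[k*s+t] : ∀ k s t → 2 ^ (k * s + t) ≡ 2 ^ t * (2 ^ s) ^ k
2^[k*s+t] k s t = begin
    2 ^ (k * s + t)        ≡⟨ ^-distribˡ-+-* 2 (k * s) t ⟩
    2 ^ (k * s) * 2 ^ t    ≡⟨ *-comm (2 ^ (k * s)) (2 ^ t) ⟩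
    2 ^ t * 2 ^ (k * s)    ≡⟨ cong (λ e → 2 ^ t * 2 ^ e) (*-comm k s) ⟩
    2 ^ t * 2 ^ (s * k)    ≡⟨ cong (2 ^ t *_) (^-*-assoc 2 s k) ⟨
    2 ^ t * (2 ^ s) ^ k    ∎
  where open ≡-Reasoning

module _ (G : ℕ → Bool) (s g : ℕ) (periodic : ∀ c → G (c + suc s) ≡ G c)
         (window : sumBelow (suc s) (indicator ∘ G) ≡ g) where

  hits : ℕ → ℕ → ℕ
  hits n c = weightSum n (λ i → indicator (G (c + i)))

  hits-window : ∀ n c → sumBelow (suc s) (λ j → hits n (c + j)) ≡ g * 2 ^ n
  hits-window n c = begin
      sumBelow (suc s) (λ j → hits n (c + j))
    ≡⟨ sumBelow-weightSum (suc s) n (λ j i → indicator (G (c + j + i))) ⟩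
      weightSum n (λ i → sumBelow (suc s) (λ j → indicator (G (c + j + i))))
    ≡⟨ weightSum-cong n (λ i → sumBelow-cong (suc s) (λ j → cong (indicator ∘ G) (+-comm-right c j i))) ⟩
      weightSum n (λ i → sumBelow (suc s) (λ j → indicator (G (c + i + j))))
    ≡⟨ weightSum-cong n (λ i → sumBelow-periodic (suc s) (indicator ∘ G) (cong indicator ∘ periodic) (c + i)) ⟩
      weightSum n (λ _ → sumBelow (suc s) (indicator ∘ G))
    ≡⟨ trans (cong (weightSum n ∘ const) window) (weightSum-const n g) ⟩
      g * 2 ^ n
    ∎
    where
      open ≡-Reasoning
      +-comm-right : ∀ a b c → a + b + c ≡ a + c + b
      +-comm-right = solve-∀

  hits-split : ∀ k t c → weightSum s (λ j → hits (k * s + t) (c + j)) ≡ hits (suc k * s + t) c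
  hits-split k t c = sym (begin
      hits (s + k * s + t) c
    ≡⟨ cong (λ n → hits n c) (+-assoc s (k * s) t) ⟩
      weightSum (s + (k * s + t)) (λ i → indicator (G (c + i)))
    ≡⟨ weightSum-+-length s (k * s + t) (λ i → indicator (G (c + i))) ⟩
      weightSum s (λ i → weightSum (k * s + t) (λ j → indicator (G (c + (i + j)))))
    ≡⟨ weightSum-cong s (λ i → weightSum-cong (k * s + t) (λ j → cong (indicator ∘ G) (+-assoc c i j))) ⟨
      weightSum s (λ j → hits (k * s + t) (c + j))
    ∎)
    where open ≡-Reasoning

  hits-lower : ∀ t k c → g * (2 ^ t * (2 ^ s) ^ k) ≤ suc s * hits (k * s + t) c + g * (2 ^ t * excess s ^ k)
  hits-lower t zero c = m≤n+m _ _
  hits-lower t (suc k) c = begin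
      g * (2 ^ t * (2 ^ s * (2 ^ s) ^ k))
    ≡⟨ cong (λ a → g * (2 ^ t * (a * (2 ^ s) ^ k))) (excess+suc s) ⟨
      g * (2 ^ t * ((e + suc s) * (2 ^ s) ^ k))
    ≡⟨ regroup e (suc s) g (2 ^ t) ((2 ^ s) ^ k) ⟩
      suc s * (g * (2 ^ t * (2 ^ s) ^ k)) + e * Y
    ≡⟨ cong (λ z → suc s * z + e * Y) (trans (hits-window n c) (cong (g *_) (2^[k*s+t] k s t))) ⟨
      suc s * sumBelow (suc s) (λ j → hits n (c + j)) + e * Y
    ≤⟨ weightSum-lower-window (suc s) X Y s (λ j → hits n (c + j)) (λ j → hits-lower t k (c + j)) ⟩
      suc s * weightSum s (λ j → hits n (c + j)) + e * X
    ≡⟨ cong₂ (λ a b → suc s * a + b) (hits-split k t c) (regroup′ e g (2 ^ t) (e ^ k)) ⟩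
      suc s * hits (suc k * s + t) c + g * (2 ^ t * e ^ suc k)
    ∎
    where
      open ≤-Reasoning
      n = k * s + t
      e = excess s
      Y = g * (2 ^ t * (2 ^ s) ^ k)
      X = g * (2 ^ t * e ^ k)
      regroup : ∀ e M g p A → g * (p * ((e + M) * A)) ≡ M * (g * (p * A)) + e * (g * (p * A))
      regroup = solve-∀
      regroup′ : ∀ e g p E → e * (g * (p * E)) ≡ g * (p * (e * E))
      regroup′ = solve-∀

e^k[e+k]≤e*a^k : ∀ e a k → suc e ≤ a → e ^ k * (e + k) ≤ e * a ^ k
e^k[e+k]≤e*a^k e a zero _ = ≤-reflexive (trans (*-identityˡ (e + 0)) (trans (+-identityʳ e) (sym (*-identityʳ e))))
e^k[e+k]≤e*a^k e a (suc k) e<a = begin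
    e ^ suc k * (e + suc k)                    ≤⟨ m≤m+n _ (e ^ k * k) ⟩
    e ^ suc k * (e + suc k) + e ^ k * k        ≡⟨ regroup e k (e ^ k) ⟩
    suc e * (e ^ k * (e + k))                  ≤⟨ *-monoʳ-≤ (suc e) (e^k[e+k]≤e*a^k e a k e<a) ⟩
    suc e * (e * a ^ k)                        ≤⟨ *-monoˡ-≤ (e * a ^ k) e<a ⟩
    a * (e * a ^ k)                            ≡⟨ x∙yz≈y∙xz a e (a ^ k) ⟩
    e * a ^ suc k                              ∎
  where
    open ≤-Reasoning
    regroup : ∀ e k p → e * p * (e + suc k) + p * k ≡ suc e * (p * (e + k))
    regroup = solve-∀

c*e^k≤a^k : ∀ c e a k → .{{NonZero e}} → suc e ≤ a → c * e ≤ k → c * e ^ k ≤ a ^ k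
c*e^k≤a^k c e a k e<a ce≤k = *-cancelˡ-≤ e (begin
    e * (c * e ^ k)     ≡⟨ regroup e c (e ^ k) ⟩
    e ^ k * (c * e)     ≤⟨ *-monoʳ-≤ (e ^ k) (≤-trans ce≤k (m≤n+m k e)) ⟩
    e ^ k * (e + k)     ≤⟨ e^k[e+k]≤e*a^k e a k e<a ⟩
    e * a ^ k           ∎)
  where
    open ≤-Reasoning
    regroup : ∀ e c p → e * (c * p) ≡ p * (c * e)
    regroup = solve-∀

weight-equidistributed : ∀ (G : ℕ → Bool) M g → 3 ≤ M → (∀ c → G (c + M) ≡ G c) →
  sumBelow M (indicator ∘ G) ≡ g → ∀ m → ∃[ N ] (∀ n → N ≤ n →
    suc m * g * 2 ^ n ≤ suc m * M * weightSum n (indicator ∘ G) + g * 2 ^ n)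
weight-equidistributed G 1 g (s≤s ())
weight-equidistributed G 2 g (s≤s (s≤s ()))
weight-equidistributed G (suc (suc (suc s′))) g _ periodic window m = suc m * e * s , bound
  where
    s = suc (suc s′)
    e = excess s
    e≢0 : NonZero e
    e≢0 = >-nonZero (≤-trans (m^n>0 2 s′) (≤-trans (m≤n+m (2 ^ s′) (mersenne s′)) (m≤m+n _ (excess (suc s′)))))
    e<2^s : suc e ≤ 2 ^ s
    e<2^s = subst (_≤ 2 ^ s) (+-comm e 1) (subst (e + 1 ≤_) (excess+suc s) (+-monoʳ-≤ e (s≤s z≤n)))
    blocks : ∀ t k → suc m * e ≤ k →
             suc m * g * 2 ^ (k * s + t) ≤ suc m * suc s * hits G s g periodic window (k * s + t) 0 + g * 2 ^ (k * s + t)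
    blocks t k k≥ = begin
        suc m * g * 2 ^ (k * s + t)
      ≡⟨ cong (suc m * g *_) (2^[k*s+t] k s t) ⟩
        suc m * g * (2 ^ t * (2 ^ s) ^ k)
      ≡⟨ *-assoc (suc m) g _ ⟩
        suc m * (g * (2 ^ t * (2 ^ s) ^ k))
      ≤⟨ *-monoʳ-≤ (suc m) (hits-lower G s g periodic window t k 0) ⟩
        suc m * (suc s * V + g * (2 ^ t * e ^ k))
      ≡⟨ regroup (suc m) (suc s) V g (2 ^ t) (e ^ k) ⟩
        suc m * suc s * V + g * (2 ^ t * (suc m * e ^ k))
      ≤⟨ +-monoʳ-≤ (suc m * suc s * V) (*-monoʳ-≤ g (*-monoʳ-≤ (2 ^ t) (c*e^k≤a^k (suc m) e (2 ^ s) k {{e≢0}} e<2^s k≥))) ⟩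
        suc m * suc s * V + g * (2 ^ t * (2 ^ s) ^ k)
      ≡⟨ cong (λ p → suc m * suc s * V + g * p) (2^[k*s+t] k s t) ⟨
        suc m * suc s * V + g * 2 ^ (k * s + t)
      ∎
      where
        open ≤-Reasoning
        V = hits G s g periodic window (k * s + t) 0
        regroup : ∀ c M V g p E → c * (M * V + g * (p * E)) ≡ c * M * V + g * (p * (c * E))
        regroup = solve-∀
    bound : ∀ n → suc m * e * s ≤ n → suc m * g * 2 ^ n ≤ suc m * suc s * weightSum n (indicator ∘ G) + g * 2 ^ n
    bound n N≤n = subst (λ n → suc m * g * 2 ^ n ≤ suc m * suc s * weightSum n (indicator ∘ G) + g * 2 ^ n)
                        (sym n≡k*s+t) (blocks (n % s) (n / s) k≥)
      where
        n≡k*s+t : n ≡ n / s * s + n % s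
        n≡k*s+t = trans (m≡m%n+[m/n]*n n s) (+-comm (n % s) (n / s * s))
        k≥ : suc m * e ≤ n / s
        k≥ = subst (_≤ n / s) (m*n/n≡m (suc m * e) s) (/-mono-≤ N≤n ≤-refl)

-- Good weights for D = 2^s

module _ (s : ℕ) where

  private instance
    2^s≢0 : NonZero (2 ^ s)
    2^s≢0 = m^n≢0 2 s
    2^[2+s]≢0 : NonZero (2 ^ (2 + s))
    2^[2+s]≢0 = m^n≢0 2 (2 + s)
    2^s*4≢0 : NonZero (2 ^ s * 4)
    2^s*4≢0 = m*n≢0 (2 ^ s) 4

  goodWeight : ℕ → Bool
  goodWeight w = goodResidue (w / 2 ^ s % 16)

  C-3·2^s-mod8 : ∀ w → T (goodWeight w) →
                 (w C (3 * 2 ^ s)) % 8 ≡ 4 * ((w C (4 * 2 ^ s)) % 2)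
  C-3·2^s-mod8 w good = begin
      (w C (3 * D)) % 8           ≡⟨ ∼-mod8 (C-quotient s w 3) 4∣qC3 ⟩
      (q C 3) % 8                 ≡⟨ qC3-mod8 ⟩
      4 * (u / 4 % 2)             ≡⟨ cong (4 *_) high-parity ⟨
      4 * ((w C (4 * D)) % 2)     ∎
    where
      open ≡-Reasoning
      D = 2 ^ s
      q = w / D
      u = q % 16
      q′ = w / 2 ^ (2 + s)
      qC3-mod8 : (q C 3) % 8 ≡ 4 * (u / 4 % 2)
      qC3-mod8 = trans (cong (λ n → (n C 3) % 8) (m≡m%n+[m/n]*n q 16))
                   (trans (C3-mod8-periodic (q / 16) u) (C3-mod8-goodResidue u (m%n<n q 16) good))
      4∣qC3 : (q C 3) % 4 ≡ 0
      4∣qC3 = begin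
        (q C 3) % 4          ≡⟨ m∣n⇒o%n%m≡o%m 4 8 (q C 3) (divides 2 refl) ⟨
        (q C 3) % 8 % 4      ≡⟨ cong (_% 4) (trans qC3-mod8 (*-comm 4 (u / 4 % 2))) ⟩
        (u / 4 % 2) * 4 % 4  ≡⟨ m*n%n≡0 (u / 4 % 2) 4 ⟩
        0                    ∎
      high : w C (4 * D) ∼ q′ C 1
      high = subst (λ b → w C b ∼ q′ C 1) (four-2^ D) (C-quotient (2 + s) w 1)
        where four-2^ : ∀ D → 1 * (2 * (2 * D)) ≡ 4 * D
              four-2^ = solve-∀
      q′≡q/4 : q′ ≡ q / 4
      q′≡q/4 = trans (/-congʳ (D*4 D)) (sym (m/n/o≡m/[n*o] w D 4))
        where D*4 : ∀ D → 2 * (2 * D) ≡ D * 4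
              D*4 = solve-∀
      high-parity : (w C (4 * D)) % 2 ≡ u / 4 % 2
      high-parity = begin
        (w C (4 * D)) % 2    ≡⟨ ∼-parity high ⟩
        (q′ C 1) % 2         ≡⟨ cong (_% 2) (trans (nC1≡n q′) q′≡q/4) ⟩
        q / 4 % 2            ≡⟨ n/4%2≡n%16/4%2 q ⟩
        u / 4 % 2            ∎

  goodWeight-periodic : ∀ c → goodWeight (c + 16 * 2 ^ s) ≡ goodWeight c
  goodWeight-periodic c = cong goodResidue (begin
      (c + 16 * D) / D % 16      ≡⟨ cong (_% 16) (+-distrib-/-∣ʳ c (divides 16 refl)) ⟩
      (c / D + 16 * D / D) % 16  ≡⟨ cong (λ q → (c / D + q) % 16) (m*n/n≡m 16 D) ⟩
      (c / D + 16) % 16          ≡⟨ [m+n]%n≡m%n (c / D) 16 ⟩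
      c / D % 16                 ∎)
    where
      open ≡-Reasoning
      D = 2 ^ s

  goodWeight-window : sumBelow (16 * 2 ^ s) (indicator ∘ goodWeight) ≡ 9 * 2 ^ s
  goodWeight-window = begin
      sumBelow (16 * D) (indicator ∘ goodWeight)
    ≡⟨ sumBelow-blocks 16 D (indicator ∘ goodWeight) ⟩
      sumBelow 16 (λ u → sumBelow D (λ r → indicator (goodWeight (u * D + r))))
    ≡⟨ sumBelow-cong 16 (λ u → sumBelow-cong< D (λ r r<D → cong (λ q → indicator (goodResidue (q % 16))) (block-index u r<D))) ⟩
      sumBelow 16 (λ u → sumBelow D (λ _ → indicator (goodResidue (u % 16))))
    ≡⟨ sumBelow-cong 16 (λ u → sumBelow-const D (indicator (goodResidue (u % 16)))) ⟩
      sumBelow 16 (λ u → D * indicator (goodResidue (u % 16)))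
    ≡⟨ sumBelow-*ˡ 16 D (λ u → indicator (goodResidue (u % 16))) ⟩
      D * sumBelow 16 (λ u → indicator (goodResidue (u % 16)))
    ≡⟨⟩
      D * 9
    ≡⟨ *-comm D 9 ⟩
      9 * D
    ∎
    where
      open ≡-Reasoning
      D = 2 ^ s
      block-index : ∀ u {r} → r < D → (u * D + r) / D ≡ u
      block-index u {r} r<D = begin
        (u * D + r) / D      ≡⟨ +-distrib-/-∣ˡ r (divides u refl) ⟩
        u * D / D + r / D    ≡⟨ cong₂ _+_ (m*n/n≡m u D) (m<n⇒m/n≡0 r<D) ⟩
        u + 0                ≡⟨ +-identityʳ u ⟩
        u                    ∎

  goodWeight-frequent : ∀ m → ∃[ N ] (∀ n → N ≤ n →
    9 * suc m * 2 ^ n ≤ 16 * suc m * weightSum n (indicator ∘ goodWeight) + 9 * 2 ^ n)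
  goodWeight-frequent m =
    let N , frequent = weight-equidistributed goodWeight (16 * D) (9 * D) 3≤16D goodWeight-periodic goodWeight-window m
    in N , λ n N≤n → *-cancelˡ-≤ D (subst₂ _≤_ (regroup (suc m) D (2 ^ n)) (regroup′ (suc m) D _ (2 ^ n)) (frequent n N≤n))
    where
      D = 2 ^ s
      3≤16D : 3 ≤ 16 * D
      3≤16D = ≤-trans (s≤s (s≤s (s≤s z≤n))) (*-monoʳ-≤ 16 (m^n>0 2 s))
      regroup : ∀ c D P → c * (9 * D) * P ≡ D * (9 * c * P)
      regroup = solve-∀
      regroup′ : ∀ c D V P → c * (16 * D) * V + 9 * D * P ≡ D * (16 * c * V + 9 * P)
      regroup′ = solve-∀

  goodWeight-agrees : ∀ {n} (x : Cube n) → T (goodWeight (weight x)) →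
    eval (homogeneousSymmetric n (degℓ (2 + s))) x ≡ lift 3 (symElem (2 ^ (2 + s))) x
  goodWeight-agrees {n} x good = begin
      eval (homogeneousSymmetric n (degℓ (2 + s))) x   ≡⟨ eval-homogeneousSymmetric n (degℓ (2 + s)) x ⟩
      (weight x C (2 * 2 ^ s + 2 ^ s)) % 8             ≡⟨ cong (λ d → (weight x C d) % 8) (three (2 ^ s)) ⟩
      (weight x C (3 * 2 ^ s)) % 8                     ≡⟨ C-3·2^s-mod8 (weight x) good ⟩
      4 * ((weight x C (4 * 2 ^ s)) % 2)               ≡⟨ cong (λ d → 4 * ((weight x C d) % 2)) (four (2 ^ s)) ⟩
      4 * ((weight x C (2 ^ (2 + s))) % 2)             ≡⟨ lift3-symElem (2 ^ (2 + s)) x ⟨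
      lift 3 (symElem (2 ^ (2 + s))) x                 ∎
    where
      open ≡-Reasoning
      three : ∀ D → 2 * D + D ≡ 3 * D
      three = solve-∀
      four : ∀ D → 4 * D ≡ 2 * (2 * D)
      four = solve-∀

  goodWeights≤agreeCount : ∀ n → weightSum n (indicator ∘ goodWeight)
    ≤ agreeCount {n} {degℓ (2 + s)} {3} (symElem (2 ^ (2 + s))) (homogeneousSymmetric n (degℓ (2 + s)))
  goodWeights≤agreeCount n = ≤-trans (≤-reflexive (sym (cubeSum-weight n (indicator ∘ goodWeight))))
    (count≤length-filter (λ x → eval (homogeneousSymmetric n (degℓ (2 + s))) x ≟ lift 3 (symElem (2 ^ (2 + s))) x)
                         (goodWeight ∘ weight) goodWeight-agrees (allCube n))

theorem3p1 : ∀ (ℓ : ℕ) → 2 ≤ ℓ → ∀ (m : ℕ) → ∃[ N ] (∀ (n : ℕ) → N ≤ n →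
    ∃[ Q ] (9 * suc m * 2 ^ n ≤ 16 * suc m * agreeCount {n} {degℓ ℓ} {3} (symElem (2 ^ ℓ)) Q + 16 * 2 ^ n))
theorem3p1 1 (s≤s ()) m
theorem3p1 (suc (suc s)) _ m = let N , frequent = goodWeight-frequent s m in N , λ n N≤n → Q n , (begin
    9 * suc m * 2 ^ n                                                  ≤⟨ frequent n N≤n ⟩
    16 * suc m * weightSum n (indicator ∘ goodWeight s) + 9 * 2 ^ n    ≤⟨ +-monoˡ-≤ (9 * 2 ^ n) (*-monoʳ-≤ (16 * suc m) (goodWeights≤agreeCount s n)) ⟩
    16 * suc m * agreement n + 9 * 2 ^ n                               ≤⟨ +-monoʳ-≤ (16 * suc m * agreement n) (*-monoˡ-≤ (2 ^ n) 9≤16) ⟩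
    16 * suc m * agreement n + 16 * 2 ^ n                              ∎)
  where
    open ≤-Reasoning
    Q : ∀ n → Poly n (degℓ (2 + s)) 3
    Q n = homogeneousSymmetric n (degℓ (2 + s))
    agreement : ℕ → ℕ
    agreement n = agreeCount {n} {degℓ (2 + s)} {3} (symElem (2 ^ (2 + s))) (Q n)
    9≤16 : 9 ≤ 16
    9≤16 = s≤s (s≤s (s≤s (s≤s (s≤s (s≤s (s≤s (s≤s (s≤s z≤n))))))))
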